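{- Let $k\ge5$ be an odd integer and let $C$ be a cycle of length $k$. Let $x,y\in V(C)$ and let $\varphi$ assign to $x$ and $y$ $\frac{k-1}{2}$-element subsets of $\{1,\dots,k\}$, disjoint if $xy\in E(C)$. Then $\varphi$ extends to a fractional $(k:\frac{k-1}{2})$-coloring of $C$ if and only if $$|\varphi(x)\cap\varphi(y)|=\frac{k-2}{4}+(-1)^{d(x,y)}\cdot\frac{k-2d(x,y)}{4},$$ where $d(x,y)$ is the distance between $x$ and $y$ in $C$.
   Context: A fractional $(k:\frac{k-1}{2})$-coloring of a graph assigns to each vertex $v$ a $\frac{k-1}{2}$-element subset $\varphi(v)\subseteq\{1,\dots,k\}$ with $\varphi(u)\cap\varphi(v)=\emptyset$ for every edge $uv$. -}

module Defs where

open import Data.Nat using (ℕ; suc; _+_; _*_; _∸_; _⊔_; _⊓_; _%_; NonZero)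
open import Data.Fin using (Fin; toℕ)
open import Data.Fin.Subset using (Subset; ∣_∣; _∩_; ⊥)
open import Data.Product using (_×_)
open import Data.Sum using (_⊎_)
open import Relation.Binary.PropositionalEquality using (_≡_)
open import Data.Integer using (ℤ; +_; -_; _-_; _^_)
  renaming (_+_ to _+ℤ_; _*_ to _*ℤ_)

Adj : (k : ℕ) .{{_ : NonZero k}} → Fin k → Fin k → Set
Adj k i j = ((toℕ i + 1) % k ≡ toℕ j) ⊎ ((toℕ j + 1) % k ≡ toℕ i)

dist : (k : ℕ) → Fin k → Fin k → ℕ
dist k i j = δ ⊓ (k ∸ δ)
  where δ = (toℕ i ∸ toℕ j) ⊔ (toℕ j ∸ toℕ i)

IsFracColoring : (k m : ℕ) .{{_ : NonZero k}} → (Fin k → Subset k) → Set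
IsFracColoring k m φ =
  (∀ v → ∣ φ v ∣ ≡ m) × (∀ u v → Adj k u v → φ u ∩ φ v ≡ ⊥)

-- 4 times the right-hand side of the formula:
-- 4 * ((k-2)/4 + (-1)^d (k-2d)/4) = (k - 2) + (-1)^d (k - 2d), in ℤ.
rhs4 : (k d : ℕ) → ℤ
rhs4 k d = (+ k - + 2) +ℤ ((- + 1) ^ d) *ℤ (+ k - + (2 * d))

module Submission where

-- A fractional colouring φ of C_k (k = 2m+1) with φ x = A and φ y = B is the same thing as a
-- closed walk of length k in the Kneser graph K(2m+1, m) which is at A at time 0 and at B at
-- time a, the number of steps from x to y: a walk of length a from A to B followed by one of
-- length k − a back.  Two consecutive vertices S, T of such a walk miss exactly one colour, so
-- |S ∩ B| + |T ∩ B| is m or m − 1.  Induction along the walk shows that a walk of length 2t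
-- from A to B exists iff m ≤ |A ∩ B| + t, and one of length 2t + 1 iff |A ∩ B| ≤ t; the walks
-- are built greedily, the next vertex being the complement of the current one minus a single
-- well-chosen colour.  One of a, k − a is even and the other odd, so the two conditions together
-- pin |A ∩ B| down to the value in the formula.

open import Defs
open import Data.Nat
  using (ℕ; zero; suc; _+_; _*_; _∸_; _⊓_; _⊔_; _≤_; _<_; _%_; NonZero; z≤n; s≤s; s≤s⁻¹)
open import Data.Nat.Properties
open import Data.Nat.DivMod using (m%n<n; %-distribˡ-+; m%n%n≡m%n; [m+n]%n≡m%n; m<n⇒m%n≡m; n%n≡0)
open import Data.Integer using (ℤ; +_; -_; _-_; _^_) renaming (_+_ to _+ℤ_; _*_ to _*ℤ_)
import Data.Integer.Properties as ℤ
open import Data.Integer.Tactic.RingSolver using (solve-∀)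
open import Data.Fin using (Fin; toℕ; fromℕ<)
open import Data.Fin.Properties using (toℕ-fromℕ<; toℕ-injective; toℕ<n)
open import Data.Fin.Subset using (Subset; ∣_∣; _∩_; ∁; ⊥; ⊤; inside; outside)
open import Data.Fin.Subset.Properties
  using (∣p∩q∣≤∣p∣; ∣p∩q∣≤∣q∣; ∣∁p∣≡n∸∣p∣; ∣⊤∣≡n; ∩-comm; ∩-assoc; ∩-idem; ∩-identityʳ; ∩-inverseʳ)
open import Data.Vec using ([]; _∷_)
open import Data.Vec.Properties using (∷-injectiveʳ)
open import Data.Product using (Σ; ∃₂; _×_; _,_; swap)
open import Data.Sum using (_⊎_; inj₁; inj₂)
open import Function.Bundles using (_⇔_; mk⇔)
open import Function.Construct.Composition using (_⇔-∘_)
open import Relation.Binary.PropositionalEquality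
open import Relation.Nullary using (contradiction; yes; no)

private variable n : ℕ

∣p∩q∣+∣∁p∩q∣≡∣q∣ : ∀ (p q : Subset n) → ∣ p ∩ q ∣ + ∣ ∁ p ∩ q ∣ ≡ ∣ q ∣
∣p∩q∣+∣∁p∩q∣≡∣q∣ []            []            = refl
∣p∩q∣+∣∁p∩q∣≡∣q∣ (inside  ∷ p) (inside  ∷ q) = cong suc (∣p∩q∣+∣∁p∩q∣≡∣q∣ p q)
∣p∩q∣+∣∁p∩q∣≡∣q∣ (outside ∷ p) (inside  ∷ q) = trans (+-suc _ _) (cong suc (∣p∩q∣+∣∁p∩q∣≡∣q∣ p q))
∣p∩q∣+∣∁p∩q∣≡∣q∣ (inside  ∷ p) (outside ∷ q) = ∣p∩q∣+∣∁p∩q∣≡∣q∣ p q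
∣p∩q∣+∣∁p∩q∣≡∣q∣ (outside ∷ p) (outside ∷ q) = ∣p∩q∣+∣∁p∩q∣≡∣q∣ p q

∣p∩r∣+∣q∩r∣+∣∁p∩∁q∩r∣≡∣r∣ : ∀ (p q r : Subset n) → p ∩ q ≡ ⊥ →
                             ∣ p ∩ r ∣ + ∣ q ∩ r ∣ + ∣ ∁ p ∩ ∁ q ∩ r ∣ ≡ ∣ r ∣
∣p∩r∣+∣q∩r∣+∣∁p∩∁q∩r∣≡∣r∣ []            []            []            _  = refl
∣p∩r∣+∣q∩r∣+∣∁p∩∁q∩r∣≡∣r∣ (inside  ∷ p) (inside  ∷ q) _             ()
∣p∩r∣+∣q∩r∣+∣∁p∩∁q∩r∣≡∣r∣ (inside  ∷ p) (outside ∷ q) (inside  ∷ r) pq =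
  cong suc (∣p∩r∣+∣q∩r∣+∣∁p∩∁q∩r∣≡∣r∣ p q r (∷-injectiveʳ pq))
∣p∩r∣+∣q∩r∣+∣∁p∩∁q∩r∣≡∣r∣ (outside ∷ p) (inside  ∷ q) (inside  ∷ r) pq =
  trans (cong (_+ ∣ ∁ p ∩ ∁ q ∩ r ∣) (+-suc ∣ p ∩ r ∣ ∣ q ∩ r ∣))
        (cong suc (∣p∩r∣+∣q∩r∣+∣∁p∩∁q∩r∣≡∣r∣ p q r (∷-injectiveʳ pq)))
∣p∩r∣+∣q∩r∣+∣∁p∩∁q∩r∣≡∣r∣ (outside ∷ p) (outside ∷ q) (inside  ∷ r) pq =
  trans (+-suc _ _) (cong suc (∣p∩r∣+∣q∩r∣+∣∁p∩∁q∩r∣≡∣r∣ p q r (∷-injectiveʳ pq)))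
∣p∩r∣+∣q∩r∣+∣∁p∩∁q∩r∣≡∣r∣ (inside  ∷ p) (outside ∷ q) (outside ∷ r) pq =
  ∣p∩r∣+∣q∩r∣+∣∁p∩∁q∩r∣≡∣r∣ p q r (∷-injectiveʳ pq)
∣p∩r∣+∣q∩r∣+∣∁p∩∁q∩r∣≡∣r∣ (outside ∷ p) (inside  ∷ q) (outside ∷ r) pq =
  ∣p∩r∣+∣q∩r∣+∣∁p∩∁q∩r∣≡∣r∣ p q r (∷-injectiveʳ pq)
∣p∩r∣+∣q∩r∣+∣∁p∩∁q∩r∣≡∣r∣ (outside ∷ p) (outside ∷ q) (outside ∷ r) pq =
  ∣p∩r∣+∣q∩r∣+∣∁p∩∁q∩r∣≡∣r∣ p q r (∷-injectiveʳ pq)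

∣p∣≤∣p∩q∣⇒∣q∣≤∣p∩q∣⇒p≡q : ∀ (p q : Subset n) → ∣ p ∣ ≤ ∣ p ∩ q ∣ → ∣ q ∣ ≤ ∣ p ∩ q ∣ → p ≡ q
∣p∣≤∣p∩q∣⇒∣q∣≤∣p∩q∣⇒p≡q []            []            _        _        = refl
∣p∣≤∣p∩q∣⇒∣q∣≤∣p∩q∣⇒p≡q (inside  ∷ p) (inside  ∷ q) (s≤s p≤) (s≤s q≤) =
  cong (inside ∷_) (∣p∣≤∣p∩q∣⇒∣q∣≤∣p∩q∣⇒p≡q p q p≤ q≤)
∣p∣≤∣p∩q∣⇒∣q∣≤∣p∩q∣⇒p≡q (inside  ∷ p) (outside ∷ q) p≤      _        =
  contradiction (∣p∩q∣≤∣p∣ p q) (<⇒≱ p≤)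
∣p∣≤∣p∩q∣⇒∣q∣≤∣p∩q∣⇒p≡q (outside ∷ p) (inside  ∷ q) _        q≤       =
  contradiction (∣p∩q∣≤∣q∣ p q) (<⇒≱ q≤)
∣p∣≤∣p∩q∣⇒∣q∣≤∣p∩q∣⇒p≡q (outside ∷ p) (outside ∷ q) p≤      q≤       =
  cong (outside ∷_) (∣p∣≤∣p∩q∣⇒∣q∣≤∣p∩q∣⇒p≡q p q p≤ q≤)

removeFirst : Subset n → Subset n → Subset n
removeFirst []            []            = []
removeFirst (inside  ∷ p) (inside  ∷ q) = outside ∷ p
removeFirst (inside  ∷ p) (outside ∷ q) = inside ∷ removeFirst p q
removeFirst (outside ∷ p) (_       ∷ q) = outside ∷ removeFirst p q

∣removeFirst∣ : ∀ (p q : Subset n) → 1 ≤ ∣ p ∩ q ∣ → suc ∣ removeFirst p q ∣ ≡ ∣ p ∣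
∣removeFirst∣ []            []            ()
∣removeFirst∣ (inside  ∷ p) (inside  ∷ q) _  = refl
∣removeFirst∣ (inside  ∷ p) (outside ∷ q) pq = cong suc (∣removeFirst∣ p q pq)
∣removeFirst∣ (outside ∷ p) (inside  ∷ q) pq = ∣removeFirst∣ p q pq
∣removeFirst∣ (outside ∷ p) (outside ∷ q) pq = ∣removeFirst∣ p q pq

∣removeFirst∩q∣ : ∀ (p q : Subset n) → 1 ≤ ∣ p ∩ q ∣ → suc ∣ removeFirst p q ∩ q ∣ ≡ ∣ p ∩ q ∣
∣removeFirst∩q∣ []            []            ()
∣removeFirst∩q∣ (inside  ∷ p) (inside  ∷ q) _  = refl
∣removeFirst∩q∣ (inside  ∷ p) (outside ∷ q) pq = ∣removeFirst∩q∣ p q pq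
∣removeFirst∩q∣ (outside ∷ p) (inside  ∷ q) pq = ∣removeFirst∩q∣ p q pq
∣removeFirst∩q∣ (outside ∷ p) (outside ∷ q) pq = ∣removeFirst∩q∣ p q pq

∣removeFirst[∁q]∩q∣ : ∀ (p q : Subset n) → ∣ removeFirst p (∁ q) ∩ q ∣ ≡ ∣ p ∩ q ∣
∣removeFirst[∁q]∩q∣ []            []            = refl
∣removeFirst[∁q]∩q∣ (inside  ∷ p) (inside  ∷ q) = cong suc (∣removeFirst[∁q]∩q∣ p q)
∣removeFirst[∁q]∩q∣ (inside  ∷ p) (outside ∷ q) = refl
∣removeFirst[∁q]∩q∣ (outside ∷ p) (inside  ∷ q) = ∣removeFirst[∁q]∩q∣ p q
∣removeFirst[∁q]∩q∣ (outside ∷ p) (outside ∷ q) = ∣removeFirst[∁q]∩q∣ p q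

p∩removeFirst[∁p]≡⊥ : ∀ (p q : Subset n) → p ∩ removeFirst (∁ p) q ≡ ⊥
p∩removeFirst[∁p]≡⊥ []            []            = refl
p∩removeFirst[∁p]≡⊥ (inside  ∷ p) (_       ∷ q) = cong (outside ∷_) (p∩removeFirst[∁p]≡⊥ p q)
p∩removeFirst[∁p]≡⊥ (outside ∷ p) (inside  ∷ q) = cong (outside ∷_) (∩-inverseʳ p)
p∩removeFirst[∁p]≡⊥ (outside ∷ p) (outside ∷ q) = cong (outside ∷_) (p∩removeFirst[∁p]≡⊥ p q)

module KneserGraph (n m : ℕ) where

  data Walk : Subset n → Subset n → ℕ → Set where
    stop : ∀ {S} → ∣ S ∣ ≡ m → Walk S S 0
    step : ∀ {S T U ℓ} → ∣ S ∣ ≡ m → S ∩ T ≡ ⊥ → Walk T U ℓ → Walk S U (suc ℓ)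

  private variable
    S T U : Subset n
    a b ℓ : ℕ

  ∣source∣ : Walk S T ℓ → ∣ S ∣ ≡ m
  ∣source∣ (stop ∣S∣)     = ∣S∣
  ∣source∣ (step ∣S∣ _ _) = ∣S∣

  step-even : ∀ {t} → ∣ S ∣ ≡ m → S ∩ T ≡ ⊥ → Walk T U (suc (2 * t)) → Walk S U (2 * suc t)
  step-even {t = t} ∣S∣ S∩T w = step ∣S∣ S∩T (subst (Walk _ _) (sym (+-suc t (t + 0))) w)

  _++_ : Walk S T a → Walk T U b → Walk S U (a + b)
  stop _         ++ q = q
  step ∣S∣ S∩T p ++ q = step ∣S∣ S∩T (p ++ q)

  vertex : Walk S T ℓ → ℕ → Subset n
  vertex {S = S} _            zero    = S
  vertex {S = S} (stop _)     (suc _) = S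
  vertex         (step _ _ w) (suc i) = vertex w i

  ∣vertex∣ : (w : Walk S T ℓ) → ∀ i → ∣ vertex w i ∣ ≡ m
  ∣vertex∣ w            zero    = ∣source∣ w
  ∣vertex∣ (stop ∣S∣)   (suc _) = ∣S∣
  ∣vertex∣ (step _ _ w) (suc i) = ∣vertex∣ w i

  vertex-disjoint : (w : Walk S T ℓ) → ∀ {i} → i < ℓ → vertex w i ∩ vertex w (suc i) ≡ ⊥
  vertex-disjoint (step _ S∩T _) {zero}  _         = S∩T
  vertex-disjoint (step _ _ w)   {suc i} (s≤s i<ℓ) = vertex-disjoint w i<ℓ

  vertex-end : (w : Walk S T ℓ) → vertex w ℓ ≡ T
  vertex-end (stop _)     = refl
  vertex-end (step _ _ w) = vertex-end w

  vertex-++ : (p : Walk S T a) (q : Walk T U b) → vertex (p ++ q) a ≡ T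
  vertex-++ (stop _)     q = refl
  vertex-++ (step _ _ p) q = vertex-++ p q

  walkAlong : (R : ℕ → Subset n) → (∀ i → ∣ R i ∣ ≡ m) → (∀ i → R i ∩ R (suc i) ≡ ⊥) →
              ∀ ℓ → Walk (R 0) (R ℓ) ℓ
  walkAlong R ∣R∣ R∩R zero    = stop (∣R∣ 0)
  walkAlong R ∣R∣ R∩R (suc ℓ) =
    step (∣R∣ 0) (R∩R 0) (walkAlong (λ i → R (suc i)) (λ i → ∣R∣ (suc i)) (λ i → R∩R (suc i)) ℓ)

module KneserDistance (m : ℕ) (B : Subset (suc (2 * m))) (∣B∣ : ∣ B ∣ ≡ m) where

  open KneserGraph (suc (2 * m)) m

  private variable S : Subset (suc (2 * m))

  ∣∁S∣≡1+m : ∀ S → ∣ S ∣ ≡ m → ∣ ∁ S ∣ ≡ suc m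
  ∣∁S∣≡1+m S ∣S∣ = begin
    ∣ ∁ S ∣                ≡⟨ ∣∁p∣≡n∸∣p∣ S ⟩
    suc (2 * m) ∸ ∣ S ∣    ≡⟨ cong (suc (2 * m) ∸_) ∣S∣ ⟩
    suc (m + (m + 0)) ∸ m  ≡⟨ cong (_∸ m) (+-suc m (m + 0)) ⟨
    m + suc (m + 0) ∸ m    ≡⟨ m+n∸m≡n m _ ⟩
    suc (m + 0)            ≡⟨ cong suc (+-identityʳ m) ⟩
    suc m                  ∎
    where open ≡-Reasoning

  ∣S∩B∣+∣∁S∩B∣≡m : ∀ S → ∣ S ∩ B ∣ + ∣ ∁ S ∩ B ∣ ≡ m
  ∣S∩B∣+∣∁S∩B∣≡m S = trans (∣p∩q∣+∣∁p∩q∣≡∣q∣ S B) ∣B∣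

  1≤∣∁S∩∁B∣ : ∀ S → ∣ S ∣ ≡ m → 1 ≤ ∣ ∁ S ∩ ∁ B ∣
  1≤∣∁S∩∁B∣ S ∣S∣ = +-cancelˡ-≤ m 1 _ (begin
    m + 1                        ≡⟨ +-comm m 1 ⟩
    suc m                        ≡⟨ ∣∁S∣≡1+m B ∣B∣ ⟨
    ∣ ∁ B ∣                      ≡⟨ ∣p∩q∣+∣∁p∩q∣≡∣q∣ S (∁ B) ⟨
    ∣ S ∩ ∁ B ∣ + ∣ ∁ S ∩ ∁ B ∣  ≤⟨ +-monoˡ-≤ _ (≤-trans (∣p∩q∣≤∣p∣ S (∁ B)) (≤-reflexive ∣S∣)) ⟩
    m + ∣ ∁ S ∩ ∁ B ∣            ∎)
    where open ≤-Reasoning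

  ∣∁S∩∁T∣≡1 : ∀ S T → ∣ S ∣ ≡ m → ∣ T ∣ ≡ m → S ∩ T ≡ ⊥ → ∣ ∁ S ∩ ∁ T ∣ ≡ 1
  ∣∁S∩∁T∣≡1 S T ∣S∣ ∣T∣ S∩T = +-cancelˡ-≡ (m + m) _ 1 (begin
    m + m + ∣ ∁ S ∩ ∁ T ∣
      ≡⟨ cong₂ (λ x y → x + y + ∣ ∁ S ∩ ∁ T ∣) (trans (cong ∣_∣ (∩-identityʳ S)) ∣S∣)
                                               (trans (cong ∣_∣ (∩-identityʳ T)) ∣T∣) ⟨
    ∣ S ∩ ⊤ ∣ + ∣ T ∩ ⊤ ∣ + ∣ ∁ S ∩ ∁ T ∣
      ≡⟨ cong (λ X → ∣ S ∩ ⊤ ∣ + ∣ T ∩ ⊤ ∣ + ∣ ∁ S ∩ X ∣) (∩-identityʳ (∁ T)) ⟨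
    ∣ S ∩ ⊤ ∣ + ∣ T ∩ ⊤ ∣ + ∣ ∁ S ∩ ∁ T ∩ ⊤ ∣
      ≡⟨ ∣p∩r∣+∣q∩r∣+∣∁p∩∁q∩r∣≡∣r∣ S T (⊤ {suc (2 * m)}) S∩T ⟩
    ∣ ⊤ {suc (2 * m)} ∣
      ≡⟨ ∣⊤∣≡n (suc (2 * m)) ⟩
    suc (m + (m + 0))
      ≡⟨ cong (λ x → suc (m + x)) (+-identityʳ m) ⟩
    suc (m + m)
      ≡⟨ +-comm 1 (m + m) ⟩
    m + m + 1 ∎)
    where open ≡-Reasoning

  ∣S∩B∣+∣T∩B∣≤m : ∀ S T → S ∩ T ≡ ⊥ → ∣ S ∩ B ∣ + ∣ T ∩ B ∣ ≤ m
  ∣S∩B∣+∣T∩B∣≤m S T S∩T = begin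
    ∣ S ∩ B ∣ + ∣ T ∩ B ∣                      ≤⟨ m≤m+n _ _ ⟩
    ∣ S ∩ B ∣ + ∣ T ∩ B ∣ + ∣ ∁ S ∩ ∁ T ∩ B ∣  ≡⟨ ∣p∩r∣+∣q∩r∣+∣∁p∩∁q∩r∣≡∣r∣ S T B S∩T ⟩
    ∣ B ∣                                      ≡⟨ ∣B∣ ⟩
    m                                          ∎
    where open ≤-Reasoning

  m≤∣S∩B∣+∣T∩B∣+1 : ∀ S T → ∣ S ∣ ≡ m → ∣ T ∣ ≡ m → S ∩ T ≡ ⊥ → m ≤ ∣ S ∩ B ∣ + ∣ T ∩ B ∣ + 1
  m≤∣S∩B∣+∣T∩B∣+1 S T ∣S∣ ∣T∣ S∩T = begin
    m                                            ≡⟨ ∣B∣ ⟨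
    ∣ B ∣                                        ≡⟨ ∣p∩r∣+∣q∩r∣+∣∁p∩∁q∩r∣≡∣r∣ S T B S∩T ⟨
    ∣ S ∩ B ∣ + ∣ T ∩ B ∣ + ∣ ∁ S ∩ ∁ T ∩ B ∣    ≡⟨ cong (λ X → ∣ S ∩ B ∣ + ∣ T ∩ B ∣ + ∣ X ∣)
                                                          (∩-assoc {n = suc (2 * m)} (∁ S) (∁ T) B) ⟨
    ∣ S ∩ B ∣ + ∣ T ∩ B ∣ + ∣ (∁ S ∩ ∁ T) ∩ B ∣  ≤⟨ +-monoʳ-≤ _ (∣p∩q∣≤∣p∣ (∁ S ∩ ∁ T) B) ⟩
    ∣ S ∩ B ∣ + ∣ T ∩ B ∣ + ∣ ∁ S ∩ ∁ T ∣        ≡⟨ cong (λ x → ∣ S ∩ B ∣ + ∣ T ∩ B ∣ + x) (∣∁S∩∁T∣≡1 S T ∣S∣ ∣T∣ S∩T) ⟩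
    ∣ S ∩ B ∣ + ∣ T ∩ B ∣ + 1                    ∎
    where open ≤-Reasoning

  walk-even-bound : ∀ t → Walk S B (2 * t) → m ≤ ∣ S ∩ B ∣ + t
  walk-odd-bound  : ∀ t → Walk S B (suc (2 * t)) → ∣ S ∩ B ∣ ≤ t

  walk-even-bound zero (stop _) = ≤-reflexive (begin
    m              ≡⟨ ∣B∣ ⟨
    ∣ B ∣          ≡⟨ cong ∣_∣ (∩-idem B) ⟨
    ∣ B ∩ B ∣      ≡⟨ +-identityʳ _ ⟨
    ∣ B ∩ B ∣ + 0  ∎)
    where open ≡-Reasoning
  walk-even-bound {S} (suc t) (step {T = T} ∣S∣ S∩T w) = begin
    m                          ≤⟨ m≤∣S∩B∣+∣T∩B∣+1 S T ∣S∣ (∣source∣ w) S∩T ⟩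
    ∣ S ∩ B ∣ + ∣ T ∩ B ∣ + 1  ≤⟨ +-monoˡ-≤ 1 (+-monoʳ-≤ ∣ S ∩ B ∣ (walk-odd-bound t w′)) ⟩
    ∣ S ∩ B ∣ + t + 1          ≡⟨ +-assoc ∣ S ∩ B ∣ t 1 ⟩
    ∣ S ∩ B ∣ + (t + 1)        ≡⟨ cong (_+_ ∣ S ∩ B ∣) (+-comm t 1) ⟩
    ∣ S ∩ B ∣ + suc t          ∎
    where
    open ≤-Reasoning
    w′ : Walk T B (suc (2 * t))
    w′ = subst (Walk T B) (+-suc t (t + 0)) w

  walk-odd-bound {S} t (step {T = T} _ S∩T w) = +-cancelʳ-≤ ∣ T ∩ B ∣ ∣ S ∩ B ∣ t (begin
    ∣ S ∩ B ∣ + ∣ T ∩ B ∣  ≤⟨ ∣S∩B∣+∣T∩B∣≤m S T S∩T ⟩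
    m                      ≤⟨ walk-even-bound t w ⟩
    ∣ T ∩ B ∣ + t          ≡⟨ +-comm ∣ T ∩ B ∣ t ⟩
    t + ∣ T ∩ B ∣          ∎)
    where open ≤-Reasoning

  away toward : Subset (suc (2 * m)) → Subset (suc (2 * m))
  away   S = removeFirst (∁ S) (∁ B)
  toward S = removeFirst (∁ S) B

  ∣away∣ : ∀ S → ∣ S ∣ ≡ m → ∣ away S ∣ ≡ m
  ∣away∣ S ∣S∣ = suc-injective (trans (∣removeFirst∣ (∁ S) (∁ B) (1≤∣∁S∩∁B∣ S ∣S∣)) (∣∁S∣≡1+m S ∣S∣))

  ∣toward∣ : ∀ S → ∣ S ∣ ≡ m → 1 ≤ ∣ ∁ S ∩ B ∣ → ∣ toward S ∣ ≡ m
  ∣toward∣ S ∣S∣ 1≤ = suc-injective (trans (∣removeFirst∣ (∁ S) B 1≤) (∣∁S∣≡1+m S ∣S∣))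

  even-walk : ∀ t → ∣ S ∣ ≡ m → m ≤ ∣ S ∩ B ∣ + t → Walk S B (2 * t)
  odd-walk  : ∀ t → ∣ S ∣ ≡ m → ∣ S ∩ B ∣ ≤ t → Walk S B (suc (2 * t))

  even-walk {S} zero ∣S∣ m≤ = subst (λ X → Walk S X 0) S≡B (stop ∣S∣)
    where
    m≤∣S∩B∣ : m ≤ ∣ S ∩ B ∣
    m≤∣S∩B∣ = subst (m ≤_) (+-identityʳ _) m≤
    S≡B : S ≡ B
    S≡B = ∣p∣≤∣p∩q∣⇒∣q∣≤∣p∩q∣⇒p≡q S B (subst (_≤ ∣ S ∩ B ∣) (sym ∣S∣) m≤∣S∩B∣)
                                      (subst (_≤ ∣ S ∩ B ∣) (sym ∣B∣) m≤∣S∩B∣)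
  even-walk {S} (suc t) ∣S∣ m≤ with m ≤? ∣ S ∩ B ∣ + t
  ... | yes m≤j+t = step-even ∣S∣ (p∩removeFirst[∁p]≡⊥ S (∁ B)) (odd-walk t (∣away∣ S ∣S∣) ∣away∩B∣≤t)
    where
    ∣away∩B∣≤t : ∣ away S ∩ B ∣ ≤ t
    ∣away∩B∣≤t = subst (_≤ t) (sym (∣removeFirst[∁q]∩q∣ (∁ S) B))
                   (+-cancelˡ-≤ ∣ S ∩ B ∣ _ t (subst (_≤ ∣ S ∩ B ∣ + t) (sym (∣S∩B∣+∣∁S∩B∣≡m S)) m≤j+t))
  ... | no m≰j+t = step-even ∣S∣ (p∩removeFirst[∁p]≡⊥ S B) (odd-walk t (∣toward∣ S ∣S∣ 1≤c) ∣toward∩B∣≤t)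
    where
    t<c : t < ∣ ∁ S ∩ B ∣
    t<c = +-cancelˡ-< ∣ S ∩ B ∣ t _ (subst (∣ S ∩ B ∣ + t <_) (sym (∣S∩B∣+∣∁S∩B∣≡m S)) (≰⇒> m≰j+t))
    1≤c : 1 ≤ ∣ ∁ S ∩ B ∣
    1≤c = ≤-trans (s≤s z≤n) t<c
    c≤1+t : ∣ ∁ S ∩ B ∣ ≤ suc t
    c≤1+t = +-cancelˡ-≤ ∣ S ∩ B ∣ _ (suc t) (subst (_≤ ∣ S ∩ B ∣ + suc t) (sym (∣S∩B∣+∣∁S∩B∣≡m S)) m≤)
    ∣toward∩B∣≤t : ∣ toward S ∩ B ∣ ≤ t
    ∣toward∩B∣≤t = s≤s⁻¹ (subst (_≤ suc t) (sym (∣removeFirst∩q∣ (∁ S) B 1≤c)) c≤1+t)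

  odd-walk {S} t ∣S∣ j≤t = step ∣S∣ (p∩removeFirst[∁p]≡⊥ S (∁ B)) (even-walk t (∣away∣ S ∣S∣) m≤)
    where
    m≤ : m ≤ ∣ away S ∩ B ∣ + t
    m≤ = begin
      m                        ≡⟨ ∣S∩B∣+∣∁S∩B∣≡m S ⟨
      ∣ S ∩ B ∣ + ∣ ∁ S ∩ B ∣  ≤⟨ +-monoˡ-≤ _ j≤t ⟩
      t + ∣ ∁ S ∩ B ∣          ≡⟨ +-comm t _ ⟩
      ∣ ∁ S ∩ B ∣ + t          ≡⟨ cong (_+ t) (∣removeFirst[∁q]∩q∣ (∁ S) B) ⟨
      ∣ away S ∩ B ∣ + t       ∎
      where open ≤-Reasoning

module Rotation (k : ℕ) .{{_ : NonZero k}} where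

  private
    [a%k+b]%k≡[a+b]%k : ∀ a b → (a % k + b) % k ≡ (a + b) % k
    [a%k+b]%k≡[a+b]%k a b = begin
      (a % k + b) % k            ≡⟨ %-distribˡ-+ (a % k) b k ⟩
      (a % k % k + b % k) % k    ≡⟨ cong (λ x → (x + b % k) % k) (m%n%n≡m%n a k) ⟩
      (a % k + b % k) % k        ≡⟨ %-distribˡ-+ a b k ⟨
      (a + b) % k                ∎
      where open ≡-Reasoning

  rotate : Fin k → ℕ → Fin k
  rotate x i = fromℕ< (m%n<n (toℕ x + i) k)

  steps : Fin k → Fin k → ℕ
  steps x v = (toℕ v + (k ∸ toℕ x)) % k

  toℕ-rotate : ∀ x i → toℕ (rotate x i) ≡ (toℕ x + i) % k
  toℕ-rotate x i = toℕ-fromℕ< (m%n<n (toℕ x + i) k)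

  steps<k : ∀ x v → steps x v < k
  steps<k x v = m%n<n (toℕ v + (k ∸ toℕ x)) k

  rotate-k : ∀ x → rotate x k ≡ x
  rotate-k x = toℕ-injective (begin
    toℕ (rotate x k)  ≡⟨ toℕ-rotate x k ⟩
    (toℕ x + k) % k   ≡⟨ [m+n]%n≡m%n (toℕ x) k ⟩
    toℕ x % k         ≡⟨ m<n⇒m%n≡m (toℕ<n x) ⟩
    toℕ x             ∎)
    where open ≡-Reasoning

  rotate-0 : ∀ x → rotate x 0 ≡ x
  rotate-0 x = toℕ-injective (trans (toℕ-rotate x 0)
    (trans (cong (_% k) (+-identityʳ (toℕ x))) (m<n⇒m%n≡m (toℕ<n x))))

  rotate-adjacent : ∀ x i → Adj k (rotate x i) (rotate x (suc i))
  rotate-adjacent x i = inj₁ (begin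
    (toℕ (rotate x i) + 1) % k   ≡⟨ cong (λ r → (r + 1) % k) (toℕ-rotate x i) ⟩
    ((toℕ x + i) % k + 1) % k    ≡⟨ [a%k+b]%k≡[a+b]%k (toℕ x + i) 1 ⟩
    (toℕ x + i + 1) % k          ≡⟨ cong (_% k) (trans (+-assoc (toℕ x) i 1) (cong (_+_ (toℕ x)) (+-comm i 1))) ⟩
    (toℕ x + suc i) % k          ≡⟨ toℕ-rotate x (suc i) ⟨
    toℕ (rotate x (suc i))       ∎)
    where open ≡-Reasoning

  rotate-steps : ∀ x y → rotate x (steps x y) ≡ y
  rotate-steps x y = toℕ-injective (begin
    toℕ (rotate x (steps x y))              ≡⟨ toℕ-rotate x (steps x y) ⟩
    (toℕ x + steps x y) % k                 ≡⟨ cong (_% k) (+-comm (toℕ x) (steps x y)) ⟩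
    (steps x y + toℕ x) % k                 ≡⟨ [a%k+b]%k≡[a+b]%k (toℕ y + (k ∸ toℕ x)) (toℕ x) ⟩
    (toℕ y + (k ∸ toℕ x) + toℕ x) % k       ≡⟨ cong (_% k) (+-assoc (toℕ y) _ _) ⟩
    (toℕ y + ((k ∸ toℕ x) + toℕ x)) % k     ≡⟨ cong (λ r → (toℕ y + r) % k) (m∸n+n≡m (<⇒≤ (toℕ<n x))) ⟩
    (toℕ y + k) % k                         ≡⟨ [m+n]%n≡m%n (toℕ y) k ⟩
    toℕ y % k                               ≡⟨ m<n⇒m%n≡m (toℕ<n y) ⟩
    toℕ y                                   ∎)
    where open ≡-Reasoning

  steps-self : ∀ x → steps x x ≡ 0
  steps-self x = trans (cong (_% k) (m+[n∸m]≡n (<⇒≤ (toℕ<n x)))) (n%n≡0 k)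

  steps-suc : ∀ x {u v} → (toℕ u + 1) % k ≡ toℕ v → steps x v ≡ (steps x u + 1) % k
  steps-suc x {u} {v} u+1≡v = begin
    (toℕ v + (k ∸ toℕ x)) % k              ≡⟨ cong (λ r → (r + (k ∸ toℕ x)) % k) u+1≡v ⟨
    ((toℕ u + 1) % k + (k ∸ toℕ x)) % k    ≡⟨ [a%k+b]%k≡[a+b]%k (toℕ u + 1) _ ⟩
    (toℕ u + 1 + (k ∸ toℕ x)) % k          ≡⟨ cong (_% k) (+-assoc (toℕ u) 1 _) ⟩
    (toℕ u + (1 + (k ∸ toℕ x))) % k        ≡⟨ cong (λ r → (toℕ u + r) % k) (+-comm 1 _) ⟩
    (toℕ u + ((k ∸ toℕ x) + 1)) % k        ≡⟨ cong (_% k) (+-assoc (toℕ u) _ 1) ⟨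
    (toℕ u + (k ∸ toℕ x) + 1) % k          ≡⟨ [a%k+b]%k≡[a+b]%k (toℕ u + (k ∸ toℕ x)) 1 ⟨
    (steps x u + 1) % k                    ∎
    where open ≡-Reasoning

  steps≡y∸x : ∀ {x y} → toℕ x ≤ toℕ y → steps x y ≡ toℕ y ∸ toℕ x
  steps≡y∸x {x} {y} x≤y = begin
    (toℕ y + (k ∸ toℕ x)) % k   ≡⟨ cong (_% k) (+-∸-assoc (toℕ y) (<⇒≤ (toℕ<n x))) ⟨
    (toℕ y + k ∸ toℕ x) % k     ≡⟨ cong (_% k) (+-∸-comm k x≤y) ⟩
    (toℕ y ∸ toℕ x + k) % k     ≡⟨ [m+n]%n≡m%n (toℕ y ∸ toℕ x) k ⟩
    (toℕ y ∸ toℕ x) % k         ≡⟨ m<n⇒m%n≡m (≤-<-trans (m∸n≤m (toℕ y) (toℕ x)) (toℕ<n y)) ⟩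
    toℕ y ∸ toℕ x               ∎
    where open ≡-Reasoning

  steps≡k∸[x∸y] : ∀ {x y} → toℕ y < toℕ x → steps x y ≡ k ∸ (toℕ x ∸ toℕ y)
  steps≡k∸[x∸y] {x} {y} y<x = begin
    (toℕ y + (k ∸ toℕ x)) % k   ≡⟨ m<n⇒m%n≡m (subst (toℕ y + (k ∸ toℕ x) <_) y+[k∸x]+δ≡k (m<m+n _ (m<n⇒0<n∸m y<x))) ⟩
    toℕ y + (k ∸ toℕ x)         ≡⟨ m+n∸n≡m _ δ ⟨
    toℕ y + (k ∸ toℕ x) + δ ∸ δ ≡⟨ cong (_∸ δ) y+[k∸x]+δ≡k ⟩
    k ∸ δ                       ∎
    where
    open ≡-Reasoning
    δ : ℕ
    δ = toℕ x ∸ toℕ y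
    y+[k∸x]+δ≡k : toℕ y + (k ∸ toℕ x) + δ ≡ k
    y+[k∸x]+δ≡k = begin
      toℕ y + (k ∸ toℕ x) + δ     ≡⟨ +-assoc (toℕ y) _ δ ⟩
      toℕ y + ((k ∸ toℕ x) + δ)   ≡⟨ cong (_+_ (toℕ y)) (+-comm _ δ) ⟩
      toℕ y + (δ + (k ∸ toℕ x))   ≡⟨ +-assoc (toℕ y) δ _ ⟨
      toℕ y + δ + (k ∸ toℕ x)     ≡⟨ cong (_+ (k ∸ toℕ x)) (m+[n∸m]≡n (<⇒≤ y<x)) ⟩
      toℕ x + (k ∸ toℕ x)         ≡⟨ m+[n∸m]≡n (<⇒≤ (toℕ<n x)) ⟩
      k                           ∎

  dist≡steps⊓ : ∀ x y → dist k x y ≡ steps x y ⊓ (k ∸ steps x y)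
  dist≡steps⊓ x y with toℕ x ≤? toℕ y
  ... | yes x≤y = cong (λ d → d ⊓ (k ∸ d)) (begin
    (toℕ x ∸ toℕ y) ⊔ (toℕ y ∸ toℕ x)  ≡⟨ cong (_⊔ (toℕ y ∸ toℕ x)) (m≤n⇒m∸n≡0 x≤y) ⟩
    toℕ y ∸ toℕ x                      ≡⟨ steps≡y∸x x≤y ⟨
    steps x y                          ∎)
    where open ≡-Reasoning
  ... | no x≰y = begin
    ((toℕ x ∸ toℕ y) ⊔ (toℕ y ∸ toℕ x)) ⊓ (k ∸ ((toℕ x ∸ toℕ y) ⊔ (toℕ y ∸ toℕ x)))
      ≡⟨ cong (λ d → d ⊓ (k ∸ d)) (trans (cong (δ ⊔_) (m≤n⇒m∸n≡0 (<⇒≤ y<x))) (⊔-identityʳ δ)) ⟩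
    δ ⊓ (k ∸ δ)                  ≡⟨ ⊓-comm δ (k ∸ δ) ⟩
    (k ∸ δ) ⊓ δ                  ≡⟨ cong ((k ∸ δ) ⊓_) (m∸[m∸n]≡n (≤-trans (m∸n≤m (toℕ x) (toℕ y)) (<⇒≤ (toℕ<n x)))) ⟨
    (k ∸ δ) ⊓ (k ∸ (k ∸ δ))      ≡⟨ cong (λ d → d ⊓ (k ∸ d)) (steps≡k∸[x∸y] y<x) ⟨
    steps x y ⊓ (k ∸ steps x y)  ∎
    where
    open ≡-Reasoning
    y<x : toℕ y < toℕ x
    y<x = ≰⇒> x≰y
    δ : ℕ
    δ = toℕ x ∸ toℕ y

module _ (k m : ℕ) .{{_ : NonZero k}} where

  open KneserGraph k m
  open Rotation k

  closed-walk-coloring : ∀ {A ℓ} (x : Fin k) (c : Walk A A ℓ) → ℓ ≡ k →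
                         IsFracColoring k m (λ v → vertex c (steps x v))
  closed-walk-coloring x c refl = (λ v → ∣vertex∣ c (steps x v)) , adjacent-disjoint
    where
    φ : Fin k → Subset k
    φ v = vertex c (steps x v)
    φ-next : ∀ {u v} → (toℕ u + 1) % k ≡ toℕ v → φ v ≡ vertex c (suc (steps x u))
    φ-next {u} {v} u+1≡v with suc (steps x u) <? k
    ... | yes i+1<k = cong (vertex c) (trans (steps-suc x u+1≡v)
                        (trans (cong (_% k) (+-comm (steps x u) 1)) (m<n⇒m%n≡m i+1<k)))
    ... | no  i+1≮k = trans (cong (vertex c) steps-v≡0) (sym (trans (cong (vertex c) i+1≡k) (vertex-end c)))
      where
      i+1≡k : suc (steps x u) ≡ k
      i+1≡k = ≤-antisym (steps<k x u) (≮⇒≥ i+1≮k)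
      steps-v≡0 : steps x v ≡ 0
      steps-v≡0 = trans (steps-suc x u+1≡v) (trans (cong (_% k) (trans (+-comm (steps x u) 1) i+1≡k)) (n%n≡0 k))
    disjoint : ∀ {u v} → (toℕ u + 1) % k ≡ toℕ v → φ u ∩ φ v ≡ ⊥
    disjoint {u} u+1≡v = subst (λ S → φ u ∩ S ≡ ⊥) (sym (φ-next u+1≡v)) (vertex-disjoint c (steps<k x u))
    adjacent-disjoint : ∀ u v → Adj k u v → φ u ∩ φ v ≡ ⊥
    adjacent-disjoint u v (inj₁ u+1≡v) = disjoint u+1≡v
    adjacent-disjoint u v (inj₂ v+1≡u) = trans (∩-comm (φ u) (φ v)) (disjoint v+1≡u)

  coloring⇔walks : ∀ (x y : Fin k) (A B : Subset k) →
    (Σ (Fin k → Subset k) λ φ → IsFracColoring k m φ × φ x ≡ A × φ y ≡ B)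
      ⇔ (Walk A B (steps x y) × Walk B A (k ∸ steps x y))
  coloring⇔walks x y A B = mk⇔ walks coloring
    where
    a : ℕ
    a = steps x y
    a+[k∸a]≡k : a + (k ∸ a) ≡ k
    a+[k∸a]≡k = m+[n∸m]≡n (<⇒≤ (steps<k x y))

    walks : (Σ (Fin k → Subset k) λ φ → IsFracColoring k m φ × φ x ≡ A × φ y ≡ B) →
            Walk A B a × Walk B A (k ∸ a)
    walks (φ , (∣φ∣ , φ-disjoint) , φx≡A , φy≡B) =
        subst₂ (λ S T → Walk S T a) R₀≡A Rₐ≡B (walkAlong R ∣R∣ R∩R a)
      , subst₂ (λ S T → Walk S T (k ∸ a)) (trans (cong R (+-identityʳ a)) Rₐ≡B) Rₖ≡A
               (walkAlong R′ (λ i → ∣R∣ (a + i)) R′∩R′ (k ∸ a))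
      where
      R : ℕ → Subset k
      R i = φ (rotate x i)
      ∣R∣ : ∀ i → ∣ R i ∣ ≡ m
      ∣R∣ i = ∣φ∣ (rotate x i)
      R∩R : ∀ i → R i ∩ R (suc i) ≡ ⊥
      R∩R i = φ-disjoint _ _ (rotate-adjacent x i)
      R₀≡A : R 0 ≡ A
      R₀≡A = trans (cong φ (rotate-0 x)) φx≡A
      Rₐ≡B : R a ≡ B
      Rₐ≡B = trans (cong φ (rotate-steps x y)) φy≡B
      Rₖ≡A : R (a + (k ∸ a)) ≡ A
      Rₖ≡A = trans (cong R a+[k∸a]≡k) (trans (cong φ (rotate-k x)) φx≡A)
      R′ : ℕ → Subset k
      R′ i = R (a + i)
      R′∩R′ : ∀ i → R′ i ∩ R′ (suc i) ≡ ⊥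
      R′∩R′ i = subst (λ j → R (a + i) ∩ R j ≡ ⊥) (sym (+-suc a i)) (R∩R (a + i))

    coloring : Walk A B a × Walk B A (k ∸ a) →
               Σ (Fin k → Subset k) λ φ → IsFracColoring k m φ × φ x ≡ A × φ y ≡ B
    coloring (p , q) = (λ v → vertex (p ++ q) (steps x v))
                     , closed-walk-coloring x (p ++ q) a+[k∸a]≡k
                     , cong (vertex (p ++ q)) (steps-self x)
                     , vertex-++ p q

module _ (m : ℕ) where

  open KneserGraph (suc (2 * m)) m

  walks⇔∣A∩B∣≡s : ∀ {A B} t s → ∣ A ∣ ≡ m → ∣ B ∣ ≡ m → t + s ≡ m →
                  (Walk A B (2 * t) × Walk B A (suc (2 * s))) ⇔ ∣ A ∩ B ∣ ≡ s
  walks⇔∣A∩B∣≡s {A} {B} t s ∣A∣ ∣B∣ t+s≡m = mk⇔ count walks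
    where
    open KneserDistance m B ∣B∣ using (walk-even-bound; even-walk)
    open KneserDistance m A ∣A∣ using (walk-odd-bound; odd-walk)
    ∣B∩A∣≡∣A∩B∣ : ∣ B ∩ A ∣ ≡ ∣ A ∩ B ∣
    ∣B∩A∣≡∣A∩B∣ = cong ∣_∣ (∩-comm B A)
    count : Walk A B (2 * t) × Walk B A (suc (2 * s)) → ∣ A ∩ B ∣ ≡ s
    count (p , q) = ≤-antisym (subst (_≤ s) ∣B∩A∣≡∣A∩B∣ (walk-odd-bound s q))
      (+-cancelʳ-≤ t s ∣ A ∩ B ∣ (subst (_≤ ∣ A ∩ B ∣ + t) (trans (sym t+s≡m) (+-comm t s)) (walk-even-bound t p)))
    walks : ∣ A ∩ B ∣ ≡ s → Walk A B (2 * t) × Walk B A (suc (2 * s))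
    walks j≡s = even-walk t ∣A∣ (≤-reflexive (trans (sym t+s≡m) (trans (+-comm t s) (cong (_+ t) (sym j≡s)))))
              , odd-walk s ∣B∣ (≤-reflexive (trans ∣B∩A∣≡∣A∩B∣ j≡s))

odd-split : ∀ m a b → a + b ≡ suc (2 * m) →
  (∃₂ λ t s → t + s ≡ m × a ≡ 2 * t × b ≡ suc (2 * s)) ⊎
  (∃₂ λ t s → t + s ≡ m × a ≡ suc (2 * t) × b ≡ 2 * s)
odd-split m zero    b a+b≡k = inj₁ (0 , m , refl , refl , a+b≡k)
odd-split m (suc a) b a+b≡k with odd-split m a (suc b) (trans (+-suc a b) a+b≡k)
... | inj₁ (t , s , t+s≡m , a≡2t , 1+b≡1+2s) =
  inj₂ (t , s , t+s≡m , cong suc a≡2t , suc-injective 1+b≡1+2s)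
... | inj₂ (t , suc s , t+s≡m , a≡1+2t , 1+b≡2s) =
  inj₁ (suc t , s , trans (sym (+-suc t s)) t+s≡m , trans (cong suc a≡1+2t) (sym (*-suc 2 t)) ,
        suc-injective (trans 1+b≡2s (*-suc 2 s)))

-1^[2n]≡1 : ∀ n → (- + 1) ^ (2 * n) ≡ + 1
-1^[2n]≡1 n = trans (sym (ℤ.^-*-assoc (- + 1) 2 n)) (ℤ.^-zeroˡ n)

+[1+2n]≡1+2n : ∀ n → + suc (2 * n) ≡ + 1 +ℤ + 2 *ℤ + n
+[1+2n]≡1+2n n = trans (ℤ.pos-+ 1 (2 * n)) (cong (+ 1 +ℤ_) (ℤ.pos-* 2 n))

rhs4-odd : ∀ m s → rhs4 (suc (2 * m)) (suc (2 * s)) ≡ + (4 * s)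
rhs4-odd m s = begin
  (K - + 2) +ℤ (- + 1) *ℤ (- + 1) ^ (2 * s) *ℤ (K - + (2 * suc (2 * s)))
    ≡⟨ cong₂ (λ P D → (K - + 2) +ℤ (- + 1) *ℤ P *ℤ (K - + 2 *ℤ D)) (-1^[2n]≡1 s) (+[1+2n]≡1+2n s) ⟩
  (K - + 2) +ℤ (- + 1) *ℤ + 1 *ℤ (K - + 2 *ℤ (+ 1 +ℤ + 2 *ℤ + s))
    ≡⟨ identity K (+ s) ⟩
  + 4 *ℤ + s
    ≡⟨ ℤ.pos-* 4 s ⟨
  + (4 * s) ∎
  where
  open ≡-Reasoning
  K : ℤ
  K = + suc (2 * m)
  identity : ∀ K S → (K - + 2) +ℤ (- + 1) *ℤ + 1 *ℤ (K - + 2 *ℤ (+ 1 +ℤ + 2 *ℤ S)) ≡ + 4 *ℤ S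
  identity = solve-∀

rhs4-even : ∀ t s → rhs4 (suc (2 * (t + s))) (2 * t) ≡ + (4 * s)
rhs4-even t s = begin
  (+ suc (2 * (t + s)) - + 2) +ℤ (- + 1) ^ (2 * t) *ℤ (+ suc (2 * (t + s)) - + (2 * (2 * t)))
    ≡⟨ cong (λ P → (+ suc (2 * (t + s)) - + 2) +ℤ P *ℤ (+ suc (2 * (t + s)) - + (2 * (2 * t))))
            (-1^[2n]≡1 t) ⟩
  (+ suc (2 * (t + s)) - + 2) +ℤ + 1 *ℤ (+ suc (2 * (t + s)) - + (2 * (2 * t)))
    ≡⟨ cong₂ (λ K D → (K - + 2) +ℤ + 1 *ℤ (K - D)) +[1+2[t+s]] +[2[2t]] ⟩
  (K - + 2) +ℤ + 1 *ℤ (K - + 2 *ℤ (+ 2 *ℤ + t))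
    ≡⟨ identity (+ t) (+ s) ⟩
  + 4 *ℤ + s
    ≡⟨ ℤ.pos-* 4 s ⟨
  + (4 * s) ∎
  where
  open ≡-Reasoning
  K : ℤ
  K = + 1 +ℤ + 2 *ℤ (+ t +ℤ + s)
  +[1+2[t+s]] : + suc (2 * (t + s)) ≡ K
  +[1+2[t+s]] = trans (+[1+2n]≡1+2n (t + s)) (cong (λ x → + 1 +ℤ + 2 *ℤ x) (ℤ.pos-+ t s))
  +[2[2t]] : + (2 * (2 * t)) ≡ + 2 *ℤ (+ 2 *ℤ + t)
  +[2[2t]] = trans (ℤ.pos-* 2 (2 * t)) (cong (+ 2 *ℤ_) (ℤ.pos-* 2 t))
  identity : ∀ T S → ((+ 1 +ℤ + 2 *ℤ (T +ℤ S)) - + 2) +ℤ + 1 *ℤ ((+ 1 +ℤ + 2 *ℤ (T +ℤ S)) - + 2 *ℤ (+ 2 *ℤ T))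
                     ≡ + 4 *ℤ S
  identity = solve-∀

-- The formula takes the same value on the even arc 2t and the odd arc 2s + 1 of the cycle,
-- so it does not matter which of the two realises the distance.
rhs4-⊓ : ∀ {m} t s → t + s ≡ m → rhs4 (suc (2 * m)) (2 * t ⊓ suc (2 * s)) ≡ + (4 * s)
rhs4-⊓ t s refl with ⊓-sel (2 * t) (suc (2 * s))
... | inj₁ ⊓≡2t   = trans (cong (rhs4 (suc (2 * (t + s)))) ⊓≡2t) (rhs4-even t s)
... | inj₂ ⊓≡1+2s = trans (cong (rhs4 (suc (2 * (t + s)))) ⊓≡1+2s) (rhs4-odd (t + s) s)

j≡s⇔formula : ∀ {m j} t s → t + s ≡ m → j ≡ s ⇔ (+ (4 * j) ≡ rhs4 (suc (2 * m)) (2 * t ⊓ suc (2 * s)))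
j≡s⇔formula {j = j} t s t+s≡m rewrite rhs4-⊓ t s t+s≡m =
  mk⇔ (cong (λ i → + (4 * i))) (λ 4j≡4s → *-cancelˡ-≡ j s 4 (ℤ.+-injective 4j≡4s))

module _ (m : ℕ) {A B : Subset (suc (2 * m))} (∣A∣ : ∣ A ∣ ≡ m) (∣B∣ : ∣ B ∣ ≡ m) where

  open KneserGraph (suc (2 * m)) m

  walks⇔formula : ∀ {a b d} → a + b ≡ suc (2 * m) → d ≡ a ⊓ b →
                  (Walk A B a × Walk B A b) ⇔ (+ (4 * ∣ A ∩ B ∣) ≡ rhs4 (suc (2 * m)) d)
  walks⇔formula {a} {b} a+b≡k refl with odd-split m a b a+b≡k
  ... | inj₁ (t , s , t+s≡m , refl , refl) =
    j≡s⇔formula t s t+s≡m ⇔-∘ walks⇔∣A∩B∣≡s m t s ∣A∣ ∣B∣ t+s≡m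
  ... | inj₂ (t , s , t+s≡m , refl , refl)
    rewrite ∩-comm A B | ⊓-comm (suc (2 * t)) (2 * s) =
    j≡s⇔formula s t s+t≡m ⇔-∘ (walks⇔∣A∩B∣≡s m s t ∣B∣ ∣A∣ s+t≡m ⇔-∘ mk⇔ swap swap)
    where
    s+t≡m : s + t ≡ m
    s+t≡m = trans (+-comm s t) t+s≡m

lemma4p2 : (m : ℕ) → 2 ≤ m → (x y : Fin (suc (2 * m))) → (A B : Subset (suc (2 * m))) →
    ∣ A ∣ ≡ m → ∣ B ∣ ≡ m → (x ≡ y → A ≡ B) → (Adj (suc (2 * m)) x y → A ∩ B ≡ ⊥) →
    (Σ (Fin (suc (2 * m)) → Subset (suc (2 * m))) (λ φ → IsFracColoring (suc (2 * m)) m φ × φ x ≡ A × φ y ≡ B))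
      ⇔ (+ (4 * ∣ A ∩ B ∣) ≡ rhs4 (suc (2 * m)) (dist (suc (2 * m)) x y))
lemma4p2 m _ x y A B ∣A∣ ∣B∣ _ _ =
  walks⇔formula m ∣A∣ ∣B∣ (m+[n∸m]≡n (<⇒≤ (steps<k x y))) (dist≡steps⊓ x y)
    ⇔-∘ coloring⇔walks (suc (2 * m)) m x y A B
  where open Rotation (suc (2 * m))
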